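{- Let $G$ be an interval graph. (i) If $V_{\Delta}(G)$ induces a connected subgraph, then $N_G[\operatorname{bulk}(G)]=N_G[V_{\Delta}(G)]$. (ii) If $H$ is an induced subgraph of $G$ with $\Delta(H)=\Delta(G)$, then $N_H[\operatorname{bulk}(H)]\subseteq N_G[\operatorname{bulk}(G)]$. (iii) If $v\in F_G$, then $N_{G-v}[\operatorname{bulk}(G-v)]=N_G[\operatorname{bulk}(G)]$.
   Context: $V_{\Delta}(G)$: vertices of maximum degree $\Delta(G)$; $N_G[X]=\bigcup_{x\in X}N_G[x]$. Coating $\operatorname{coat}_G(S)$: set of vertices $x$ such that some induced path (possibly a single vertex) with both ends in $S$ contains $x$. $\operatorname{Span}_G(S)=\{v\in N_G[\operatorname{coat}_G(S)]: N_G[v]\subseteq N_G[\operatorname{coat}_G(S)]\}$. $\operatorname{bulk}(G)=\operatorname{Span}_G(V_{\Delta}(G))$ and $F_G=V(G)\setminus N_G[\operatorname{bulk}(G)]$ (the set of flank vertices). -}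

module Defs where

open import Data.Nat using (ℕ; zero; suc; _≤_; _⊔_)
open import Data.Fin using (Fin; toℕ; fromℕ; _≟_) renaming (zero to fzero)
open import Data.Bool using (Bool; true; false; T; _∧_; not; if_then_else_)
open import Data.List using (List; map; foldr; allFin)
open import Data.Nat.ListAction using (sum)
open import Data.Product using (Σ; ∃; _×_; _,_)
open import Data.Sum using (_⊎_)
open import Relation.Nullary using (¬_)
open import Relation.Nullary.Decidable using (⌊_⌋)
open import Relation.Binary.PropositionalEquality using (_≡_; _≢_)
open import Function using (Injective)

record Graph (n : ℕ) : Set where
  field
    adj   : Fin n → Fin n → Bool
    sym   : ∀ u v → adj u v ≡ adj v u
    irrefl : ∀ v → adj v v ≡ false
open Graph public

-- Interval graph: closed intervals [l v, r v] (integer endpoints suffice for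
-- finite interval graphs); distinct vertices adjacent iff intervals intersect.
IsInterval : ∀ {n} → Graph n → Set
IsInterval {n} G =
  Σ (Fin n → ℕ) λ l → Σ (Fin n → ℕ) λ r →
    (∀ v → l v ≤ r v) ×
    (∀ u v → u ≢ v → (T (adj G u v) → (l u ≤ r v × l v ≤ r u))
                    × ((l u ≤ r v × l v ≤ r u) → T (adj G u v)))

-- Vertex subsets of Fin n as Boolean predicates; an induced subgraph of G
-- is G[S] for such an S.
VSet : ℕ → Set
VSet n = Fin n → Bool

full : ∀ {n} → VSet n
full _ = true

delete : ∀ {n} → Fin n → VSet n
delete v u = not ⌊ u ≟ v ⌋

Pred : ℕ → Set₁
Pred n = Fin n → Set

_⊆_ : ∀ {n} → Pred n → Pred n → Set
A ⊆ B = ∀ v → A v → B v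

_≐_ : ∀ {n} → Pred n → Pred n → Set
A ≐ B = (A ⊆ B) × (B ⊆ A)

module _ {n : ℕ} (G : Graph n) (S : VSet n) where

  deg : Fin n → ℕ
  deg v = sum (map (λ u → if S u ∧ adj G v u then 1 else 0) (allFin n))

  -- maximum degree Δ(G[S]) (0 for the empty graph)
  Δ : ℕ
  Δ = foldr (λ v m → if S v then deg v ⊔ m else m) 0 (allFin n)

  VΔ : Pred n
  VΔ v = T (S v) × deg v ≡ Δ

  N[_] : Pred n → Pred n
  N[ X ] v = T (S v) × ∃ λ x → X x × (x ≡ v ⊎ T (adj G x v))

  Connected : Pred n → Set
  Connected X = ∀ x y → X x → X y →
    Σ ℕ λ k → Σ (Fin (suc k) → Fin n) λ f →
      f fzero ≡ x × f (fromℕ k) ≡ y × (∀ i → X (f i) × T (S (f i))) ×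
      (∀ (i j : Fin (suc k)) → toℕ j ≡ suc (toℕ i) → T (adj G (f i) (f j)))

  IsInducedPath : ∀ {k} → (Fin (suc k) → Fin n) → Set
  IsInducedPath {k} f =
    Injective _≡_ _≡_ f × (∀ i → T (S (f i))) ×
    (∀ i j → (T (adj G (f i) (f j)) → (toℕ j ≡ suc (toℕ i) ⊎ toℕ i ≡ suc (toℕ j)))
           × ((toℕ j ≡ suc (toℕ i) ⊎ toℕ i ≡ suc (toℕ j)) → T (adj G (f i) (f j))))

  coat : Pred n → Pred n
  coat X x = Σ ℕ λ k → Σ (Fin (suc k) → Fin n) λ f →
    IsInducedPath f × X (f fzero) × X (f (fromℕ k)) × ∃ λ i → f i ≡ x

  Span : Pred n → Pred n
  Span X v = N[ coat X ] v × (N[ (λ u → u ≡ v) ] ⊆ N[ coat X ])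

  bulk : Pred n
  bulk = Span VΔ

  Flank : Pred n
  Flank v = T (S v) × ¬ N[ bulk ] v

-- Parts (ii) and (iii) hold in every graph. Since N[Span X] = N[coat X], they reduce to
-- comparing coatings: in an induced subgraph with the same maximum degree, a vertex of maximum
-- degree has maximum degree in G as well, so the coating shrinks; and a flank vertex is neither
-- on nor adjacent to the coating, so deleting it preserves Δ and every degree on the coating.
--
-- Part (i) is geometric. Take an induced path g₀ … g_K whose ends have maximum degree, in an
-- interval model. If some interval g_i started to the left of both ends, then following the
-- path from g_i towards the end that starts further right shows that g_i = g₁ and that the
-- interval of g₀ lies inside that of g₁; as g₂ is adjacent to g₁ but not to g₀, this gives
-- deg g₁ > deg g₀ = Δ. Hence every point of an interval on the coating lies between the left
-- end of one endpoint and the right end of the other, and a walk through the connected set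
-- V_Δ from one endpoint to the other covers it.

module Submission where

open import Defs hiding (sym)
open import Level using () renaming (_⊔_ to _⊔ˡ_)
open import Function using (_∘_; id; _⇔_; mk⇔; Equivalence; Injective)
open import Data.Nat
  using (ℕ; zero; suc; _+_; _∸_; _⊔_; _≤_; _<_; z≤n; s≤s; s≤s⁻¹; s<s⁻¹; _<?_)
  renaming (_≟_ to _≟ℕ_)
open import Data.Nat.Properties
  using (≤-refl; ≤-trans; ≤-antisym; ≤-total; ≤-decTotalOrder; <⇒≤; <⇒≢; <⇒≱; ≤∧≢⇒<;
         n≢0⇒n>0; m≤n⇒m≤1+n; m≤n⇒m<n∨m≡n; +-mono-≤; +-mono-≤-<; +-mono-<-≤; +-suc; +-cancelˡ-≡;
         m∸n≤m; m∸n+n≡m; m∸[m∸n]≡n; n∸n≡0; +-∸-assoc; ∸-cancelˡ-≡;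
         m≤m⊔n; m≤n⊔m; ⊔-lub; m≤n⇒m⊔n≡n; m≥n⇒m⊔n≡m)
open import Data.Fin using (Fin; toℕ; fromℕ; fromℕ<; _≟_) renaming (zero to fzero; suc to fsuc)
open import Data.Fin.Properties using (suc-injective; toℕ<n; toℕ-fromℕ; toℕ-fromℕ<; fromℕ<-toℕ)
open import Data.Bool using (Bool; true; false; T; _∧_; _∨_; if_then_else_)
open import Data.Bool.Properties using (T-∧; T-∨; T-not-≡)
open import Data.List using ([]; _∷_; map; foldr; allFin)
open import Data.List.Properties using (map-tabulate; map-cong)
open import Data.List.Membership.Propositional using (_∈_)
open import Data.List.Membership.Propositional.Properties using (∈-allFin)
open import Data.List.Relation.Unary.Any using (here; there)
open import Data.Nat.ListAction using (sum)
open import Data.Product using (_×_; ∃; ∃₂; _,_; proj₁; proj₂; swap)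
open import Data.Sum using (_⊎_; inj₁; inj₂; [_,_])
import Data.Sum as Sum
open import Data.Empty using (⊥; ⊥-elim)
open import Data.Unit using (tt)
open import Relation.Nullary using (¬_; yes; no; contradiction)
open import Relation.Nullary.Decidable using (⌊_⌋; toWitness; fromWitness; fromWitnessFalse)
open import Relation.Binary.PropositionalEquality
  using (_≡_; _≢_; refl; sym; trans; cong; cong₂; subst; subst₂; module ≡-Reasoning)
open import Relation.Binary.Bundles using (DecTotalOrder)
import Relation.Binary.Construct.Flip.Ord as Flip

open Equivalence using (to; from)

indicator : Bool → ℕ
indicator b = if b then 1 else 0

count : ∀ {n} → (Fin n → Bool) → ℕ
count {n} p = sum (map (indicator ∘ p) (allFin n))

count-suc : ∀ {n} (p : Fin (suc n) → Bool) → count p ≡ indicator (p fzero) + count (p ∘ fsuc)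
count-suc p = cong (indicator (p fzero) +_)
  (cong sum (trans (map-tabulate fsuc (indicator ∘ p)) (sym (map-tabulate id (indicator ∘ p ∘ fsuc)))))

indicator-mono : ∀ {a b} → (T a → T b) → indicator a ≤ indicator b
indicator-mono {false} _ = z≤n
indicator-mono {true} {true} _ = ≤-refl
indicator-mono {true} {false} a⇒b = ⊥-elim (a⇒b tt)

indicator-< : ∀ {a b} → ¬ T a → T b → indicator a < indicator b
indicator-< {false} {true} _ _ = s≤s z≤n
indicator-< {true} ¬a _ = ⊥-elim (¬a tt)

indicator-true : ∀ {b} → T b → indicator b ≡ 1
indicator-true {true} _ = refl

indicator-false : ∀ {b} → ¬ T b → indicator b ≡ 0
indicator-false {false} _ = refl
indicator-false {true} ¬b = ⊥-elim (¬b tt)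

count-cong : ∀ {n} {p q : Fin n → Bool} → (∀ u → p u ≡ q u) → count p ≡ count q
count-cong {n} p≗q = cong sum (map-cong (cong indicator ∘ p≗q) (allFin n))

count-mono : ∀ {n} {p q : Fin n → Bool} → (∀ u → T (p u) → T (q u)) → count p ≤ count q
count-mono {zero} _ = z≤n
count-mono {suc n} {p} {q} p⊆q rewrite count-suc p | count-suc q =
  +-mono-≤ (indicator-mono (p⊆q fzero)) (count-mono (p⊆q ∘ fsuc))

count-< : ∀ {n} {p q : Fin n → Bool} → (∀ u → T (p u) → T (q u)) →
          ∀ w → ¬ T (p w) → T (q w) → count p < count q
count-< {suc n} {p} {q} p⊆q fzero ¬pw qw rewrite count-suc p | count-suc q =
  +-mono-<-≤ (indicator-< ¬pw qw) (count-mono (p⊆q ∘ fsuc))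
count-< {suc n} {p} {q} p⊆q (fsuc w) ¬pw qw rewrite count-suc p | count-suc q =
  +-mono-≤-< (indicator-mono (p⊆q fzero)) (count-< (p⊆q ∘ fsuc) w ¬pw qw)

count-insert : ∀ {n} {p q : Fin n → Bool} a → ¬ T (p a) → T (q a) → (∀ u → u ≢ a → q u ≡ p u) →
               count q ≡ suc (count p)
count-insert {suc n} {p} {q} fzero ¬pa qa q≗p = begin
  count q
    ≡⟨ count-suc q ⟩
  indicator (q fzero) + count (q ∘ fsuc)
    ≡⟨ cong₂ _+_ (indicator-true qa) (count-cong (λ u → q≗p (fsuc u) λ ())) ⟩
  suc (count (p ∘ fsuc))
    ≡⟨ cong (λ m → suc (m + count (p ∘ fsuc))) (sym (indicator-false ¬pa)) ⟩
  suc (indicator (p fzero) + count (p ∘ fsuc))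
    ≡⟨ cong suc (sym (count-suc p)) ⟩
  suc (count p) ∎
  where open ≡-Reasoning
count-insert {suc n} {p} {q} (fsuc a) ¬pa qa q≗p = begin
  count q
    ≡⟨ count-suc q ⟩
  indicator (q fzero) + count (q ∘ fsuc)
    ≡⟨ cong₂ _+_ (cong indicator (q≗p fzero λ ())) (count-insert a ¬pa qa q∘suc≗p∘suc) ⟩
  indicator (p fzero) + suc (count (p ∘ fsuc))
    ≡⟨ +-suc (indicator (p fzero)) (count (p ∘ fsuc)) ⟩
  suc (indicator (p fzero) + count (p ∘ fsuc))
    ≡⟨ cong suc (sym (count-suc p)) ⟩
  suc (count p) ∎
  where
  open ≡-Reasoning
  q∘suc≗p∘suc : ∀ u → u ≢ a → q (fsuc u) ≡ p (fsuc u)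
  q∘suc≗p∘suc u u≢a = q≗p (fsuc u) (u≢a ∘ suc-injective)

Adj⁼ : ∀ {n} → Graph n → Fin n → Fin n → Set
Adj⁼ G x v = x ≡ v ⊎ T (adj G x v)

T-delete : ∀ {n} {u v : Fin n} → u ≢ v → T (delete v u)
T-delete = fromWitnessFalse

module _ {n} (G : Graph n) where

  adj-sym : ∀ {u v} → T (adj G u v) → T (adj G v u)
  adj-sym {u} {v} = subst T (Graph.sym G u v)

  adj⇒≢ : ∀ {u v} → T (adj G u v) → u ≢ v
  adj⇒≢ {u} uv refl = subst T (irrefl G u) uv

  deg-induced≤deg : ∀ S v → deg G S v ≤ deg G full v
  deg-induced≤deg S v = count-mono {p = λ u → S u ∧ adj G v u} (λ u → proj₂ ∘ T-∧ .to)

  deg-delete-nonadjacent : ∀ {v w} → ¬ T (adj G w v) → deg G (delete v) w ≡ deg G full w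
  deg-delete-nonadjacent {v} {w} ¬wv =
    ≤-antisym (deg-induced≤deg (delete v) w) (count-mono {p = adj G w} kept)
    where
    kept : ∀ u → T (adj G w u) → T (delete v u ∧ adj G w u)
    kept u wu = T-∧ .from (T-delete (λ { refl → ¬wv wu }) , wu)

  closedNbhd : Fin n → Fin n → Bool
  closedNbhd a u = ⌊ u ≟ a ⌋ ∨ adj G a u

  count-closedNbhd : ∀ a → count (closedNbhd a) ≡ suc (deg G full a)
  count-closedNbhd a =
    count-insert {p = adj G a} a (subst T (irrefl G a)) (T-∨ .from (inj₁ (fromWitness {a? = a ≟ a} refl)))
      (λ u u≢a → cong (_∨ adj G a u) (T-not-≡ .to (fromWitnessFalse u≢a)))

  T-closedNbhd : ∀ {a u} → T (closedNbhd a u) ⇔ Adj⁼ G a u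
  T-closedNbhd = mk⇔ (Sum.map (sym ∘ toWitness) id ∘ T-∨ .to) (T-∨ .from ∘ Sum.map (fromWitness ∘ sym) id)

  Adj⁼⊂⇒deg< : ∀ {a b q} → (∀ {u} → Adj⁼ G a u → Adj⁼ G b u) → ¬ Adj⁼ G a q → Adj⁼ G b q →
               deg G full a < deg G full b
  Adj⁼⊂⇒deg< {a} {b} {q} a⊆b ¬aq bq = s<s⁻¹ (subst₂ _<_ (count-closedNbhd a) (count-closedNbhd b)
    (count-< (λ u → T-closedNbhd .from ∘ a⊆b ∘ T-closedNbhd .to) q
             (¬aq ∘ T-closedNbhd .to) (T-closedNbhd .from bq)))

module _ {n} (G : Graph n) (S : VSet n) where

  private
    step : Fin n → ℕ → ℕ
    step v m = if S v then deg G S v ⊔ m else m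

    foldr-step-upper : ∀ {v} xs → v ∈ xs → T (S v) → deg G S v ≤ foldr step 0 xs
    foldr-step-upper (x ∷ xs) (here refl) Sx with S x
    ... | true = m≤m⊔n (deg G S x) (foldr step 0 xs)
    foldr-step-upper (x ∷ xs) (there v∈xs) Sv with S x
    ... | true = ≤-trans (foldr-step-upper xs v∈xs Sv) (m≤n⊔m (deg G S x) (foldr step 0 xs))
    ... | false = foldr-step-upper xs v∈xs Sv

    foldr-step-least : ∀ {m} → (∀ v → T (S v) → deg G S v ≤ m) → ∀ xs → foldr step 0 xs ≤ m
    foldr-step-least bound [] = z≤n
    foldr-step-least bound (x ∷ xs) with S x in Sx
    ... | true = ⊔-lub (bound x (subst T (sym Sx) tt)) (foldr-step-least bound xs)
    ... | false = foldr-step-least bound xs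

    foldr-step-attained : ∀ xs → foldr step 0 xs ≡ 0 ⊎ ∃ λ v → T (S v) × deg G S v ≡ foldr step 0 xs
    foldr-step-attained [] = inj₁ refl
    foldr-step-attained (x ∷ xs) with S x in Sx
    ... | false = foldr-step-attained xs
    ... | true with ≤-total (deg G S x) (foldr step 0 xs)
    ...   | inj₂ rest≤x = inj₂ (x , subst T (sym Sx) tt , sym (m≥n⇒m⊔n≡m rest≤x))
    ...   | inj₁ x≤rest rewrite m≤n⇒m⊔n≡n x≤rest = foldr-step-attained xs

  deg≤Δ : ∀ v → T (S v) → deg G S v ≤ Δ G S
  deg≤Δ v Sv = foldr-step-upper (allFin n) (∈-allFin v) Sv

  Δ-least : ∀ {m} → (∀ v → T (S v) → deg G S v ≤ m) → Δ G S ≤ m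
  Δ-least bound = foldr-step-least bound (allFin n)

  Δ-attained : Δ G S ≡ 0 ⊎ ∃ (VΔ G S)
  Δ-attained = foldr-step-attained (allFin n)

  N-mono : ∀ {X Y} → X ⊆ Y → N[_] G S X ⊆ N[_] G S Y
  N-mono X⊆Y v (Sv , x , x∈X , x∼v) = Sv , x , X⊆Y x x∈X , x∼v

  coat⊆S : ∀ {X c} → coat G S X c → T (S c)
  coat⊆S (_ , f , (_ , inS , _) , _ , _ , i , refl) = inS i

  ⊆coat : ∀ {X} → (∀ x → X x → T (S x)) → X ⊆ coat G S X
  ⊆coat X⊆S x x∈X =
    0 , (λ _ → x) , (constant-injective , (λ _ → X⊆S x x∈X) , no-edge) , x∈X , x∈X , fzero , refl
    where
    constant-injective : Injective _≡_ _≡_ (λ (_ : Fin 1) → x)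
    constant-injective {fzero} {fzero} _ = refl
    no-edge : ∀ (i j : Fin 1) → (T (adj G x x) → toℕ j ≡ suc (toℕ i) ⊎ toℕ i ≡ suc (toℕ j)) ×
                                 (toℕ j ≡ suc (toℕ i) ⊎ toℕ i ≡ suc (toℕ j) → T (adj G x x))
    no-edge fzero fzero = (λ xx → ⊥-elim (adj⇒≢ G xx refl)) , [ (λ ()) , (λ ()) ]

  coat⊆Span : ∀ X → coat G S X ⊆ Span G S X
  coat⊆Span X c c∈coat =
    (coat⊆S {X} c∈coat , c , c∈coat , inj₁ refl) , λ { u (Su , _ , refl , c∼u) → Su , c , c∈coat , c∼u }

  N-Span≐N-coat : ∀ X → N[_] G S (Span G S X) ≐ N[_] G S (coat G S X)
  N-Span≐N-coat X =
    (λ { v (Sv , b , (_ , N[b]⊆) , b∼v) → N[b]⊆ v (Sv , b , refl , b∼v) }) , N-mono (coat⊆Span X)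

module _ {n} (G : Graph n) (S S′ : VSet n) (X Y : Pred n) where

  N-coat-transport : (∀ u → N[_] G S (coat G S X) u → T (S′ u)) → (∀ u → coat G S X u → X u → Y u) →
                     N[_] G S (coat G S X) ⊆ N[_] G S′ (coat G S′ Y)
  N-coat-transport N⊆S′ X⇒Y v v∈N@(_ , c , c∈coat , c∼v) = N⊆S′ v v∈N , c , transport c∈coat , c∼v
    where
    transport : ∀ {c} → coat G S X c → coat G S′ Y c
    transport (k , f , (inj , inS , chordless) , X₀ , Xₖ , i , fi) =
      k , f , (inj , (λ j → N⊆S′ (f j) (inS j , f j , on j , inj₁ refl)) , chordless) ,
      X⇒Y _ (on fzero) X₀ , X⇒Y _ (on (fromℕ k)) Xₖ , i , fi
      where
      on : ∀ j → coat G S X (f j)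
      on j = k , f , (inj , inS , chordless) , X₀ , Xₖ , j , refl

module _ {n} (G : Graph n) where

  VΔ-induced⊆VΔ : ∀ {S} → Δ G S ≡ Δ G full → VΔ G S ⊆ VΔ G full
  VΔ-induced⊆VΔ {S} ΔS≡Δ u (_ , degS≡ΔS) = tt , ≤-antisym (deg≤Δ G full u tt)
    (subst (_≤ deg G full u) (trans degS≡ΔS ΔS≡Δ) (deg-induced≤deg G S u))

  N-bulk-induced⊆N-bulk : ∀ S → Δ G S ≡ Δ G full → N[_] G S (bulk G S) ⊆ N[_] G full (bulk G full)
  N-bulk-induced⊆N-bulk S ΔS≡Δ v =
    proj₂ (N-Span≐N-coat G full (VΔ G full)) v
    ∘ N-coat-transport G S full (VΔ G S) (VΔ G full) (λ _ _ → tt) (λ u _ → VΔ-induced⊆VΔ ΔS≡Δ u) v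
    ∘ proj₁ (N-Span≐N-coat G S (VΔ G S)) v

  module _ {v} (v∉N-coat : ¬ N[_] G full (coat G full (VΔ G full)) v) where

    private
      coat-far-from-v : ∀ {u} → coat G full (VΔ G full) u → ¬ Adj⁼ G u v
      coat-far-from-v {u} u∈coat u∼v = v∉N-coat (tt , u , u∈coat , u∼v)

      coat⊆G-v : ∀ {u} → coat G full (VΔ G full) u → T (delete v u)
      coat⊆G-v u∈coat = T-delete (coat-far-from-v u∈coat ∘ inj₁)

      deg-delete-coat : ∀ {u} → coat G full (VΔ G full) u → deg G (delete v) u ≡ deg G full u
      deg-delete-coat u∈coat = deg-delete-nonadjacent G (coat-far-from-v u∈coat ∘ inj₂)

    Δ-delete : Δ G (delete v) ≡ Δ G full
    Δ-delete = ≤-antisym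
      (Δ-least G (delete v) λ u _ → ≤-trans (deg-induced≤deg G (delete v) u) (deg≤Δ G full u tt))
      Δ≤Δ-delete
      where
      Δ≤Δ-delete : Δ G full ≤ Δ G (delete v)
      Δ≤Δ-delete with Δ-attained G full
      ... | inj₁ Δ≡0 = subst (_≤ Δ G (delete v)) (sym Δ≡0) z≤n
      ... | inj₂ (w , w∈VΔ) = subst (_≤ Δ G (delete v)) (trans (deg-delete-coat w∈coat) (proj₂ w∈VΔ))
                                (deg≤Δ G (delete v) w (coat⊆G-v w∈coat))
        where
        w∈coat : coat G full (VΔ G full) w
        w∈coat = ⊆coat G full (λ _ _ → tt) w w∈VΔ

    N-coat⊆N-coat-delete :
      N[_] G full (coat G full (VΔ G full)) ⊆ N[_] G (delete v) (coat G (delete v) (VΔ G (delete v)))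
    N-coat⊆N-coat-delete =
      N-coat-transport G full (delete v) (VΔ G full) (VΔ G (delete v))
        (λ u u∈N → T-delete λ { refl → v∉N-coat u∈N })
        (λ u u∈coat u∈VΔ → coat⊆G-v u∈coat ,
                            trans (deg-delete-coat u∈coat) (trans (proj₂ u∈VΔ) (sym Δ-delete)))

  N-bulk-delete≐N-bulk : ∀ {v} → Flank G full v →
                         N[_] G (delete v) (bulk G (delete v)) ≐ N[_] G full (bulk G full)
  N-bulk-delete≐N-bulk {v} (_ , v∉N-bulk) =
    N-bulk-induced⊆N-bulk (delete v) (Δ-delete v∉N-coat) ,
    λ u → proj₂ (N-Span≐N-coat G (delete v) (VΔ G (delete v))) u
          ∘ N-coat⊆N-coat-delete v∉N-coat u
          ∘ proj₁ (N-Span≐N-coat G full (VΔ G full)) u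
    where
    v∉N-coat : ¬ N[_] G full (coat G full (VΔ G full)) v
    v∉N-coat = v∉N-bulk ∘ proj₂ (N-Span≐N-coat G full (VΔ G full)) v

-- Paths indexed by ℕ rather than by Fin, so that they can be followed by induction;
-- only the indices up to K matter.
Walk : ∀ {n} → Graph n → ℕ → (ℕ → Fin n) → Set
Walk G K g = ∀ {i} → suc i ≤ K → T (adj G (g i) (g (suc i)))

record InducedPath {n} (G : Graph n) (K : ℕ) (g : ℕ → Fin n) : Set where
  field
    walk      : Walk G K g
    chordless : ∀ {i j} → i ≤ K → j ≤ K → T (adj G (g i) (g j)) → j ≡ suc i ⊎ i ≡ suc j
    injective : ∀ {i j} → i ≤ K → j ≤ K → g i ≡ g j → i ≡ j

m∸o≡1+m∸n⇒n≡1+o : ∀ {m n o} → n ≤ m → o ≤ m → m ∸ o ≡ suc (m ∸ n) → n ≡ suc o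
m∸o≡1+m∸n⇒n≡1+o {m} {n} {o} n≤m o≤m eq = +-cancelˡ-≡ (m ∸ n) n (suc o) (begin
  m ∸ n + n       ≡⟨ m∸n+n≡m n≤m ⟩
  m               ≡⟨ sym (m∸n+n≡m o≤m) ⟩
  m ∸ o + o       ≡⟨ cong (_+ o) eq ⟩
  suc (m ∸ n) + o ≡⟨ sym (+-suc (m ∸ n) o) ⟩
  m ∸ n + suc o   ∎)
  where open ≡-Reasoning

reverse : ∀ {n} {G : Graph n} {K g} → InducedPath G K g → InducedPath G K (λ i → g (K ∸ i))
reverse {G = G} {K} {g} P = record
  { walk      = walk′
  ; chordless = λ {i} {j} i≤K j≤K ij →
      Sum.swap (Sum.map (m∸o≡1+m∸n⇒n≡1+o i≤K j≤K) (m∸o≡1+m∸n⇒n≡1+o j≤K i≤K)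
                        (chordless (m∸n≤m K i) (m∸n≤m K j) ij))
  ; injective = λ {i} {j} i≤K j≤K eq →
      ∸-cancelˡ-≡ i≤K j≤K (injective (m∸n≤m K i) (m∸n≤m K j) eq)
  }
  where
  open InducedPath P
  walk′ : Walk G K (λ i → g (K ∸ i))
  walk′ {i} 1+i≤K = subst (λ m → T (adj G (g m) (g (K ∸ suc i)))) (sym K∸i≡1+K∸1+i)
    (adj-sym G (walk (subst (_≤ K) K∸i≡1+K∸1+i (m∸n≤m K i))))
    where
    K∸i≡1+K∸1+i : K ∸ i ≡ suc (K ∸ suc i)
    K∸i≡1+K∸1+i = +-∸-assoc 1 1+i≤K

index : ∀ {i k} → i ≤ k → Fin (suc k)
index i≤k = fromℕ< (s≤s i≤k)

toℕ-index : ∀ {i k} (i≤k : i ≤ k) → toℕ (index i≤k) ≡ i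
toℕ-index i≤k = toℕ-fromℕ< (s≤s i≤k)

module _ {a} {A : Set a} {k : ℕ} (f : Fin (suc k) → A) where

  extend : ℕ → A
  extend m with m <? suc k
  ... | yes m<1+k = f (fromℕ< m<1+k)
  ... | no _ = f fzero

  extend-fromℕ< : ∀ {m} (m<1+k : m < suc k) → extend m ≡ f (fromℕ< m<1+k)
  extend-fromℕ< {m} m<1+k with m <? suc k
  ... | yes _ = refl
  ... | no m≮1+k = contradiction m<1+k m≮1+k

  extend-index : ∀ {i} (i≤k : i ≤ k) → extend i ≡ f (index i≤k)
  extend-index i≤k = extend-fromℕ< (s≤s i≤k)

  extend-toℕ : ∀ i → extend (toℕ i) ≡ f i
  extend-toℕ i = trans (extend-fromℕ< (toℕ<n i)) (cong f (fromℕ<-toℕ i (toℕ<n i)))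

  extend-last : extend k ≡ f (fromℕ k)
  extend-last = trans (cong extend (sym (toℕ-fromℕ k))) (extend-toℕ (fromℕ k))

module _ {n} (G : Graph n) where

  consecutive⇒Walk : ∀ {k} {f : Fin (suc k) → Fin n} →
                     (∀ i j → toℕ j ≡ suc (toℕ i) → T (adj G (f i) (f j))) → Walk G k (extend f)
  consecutive⇒Walk {k} {f} step {i} 1+i≤k =
    subst₂ (λ x y → T (adj G x y)) (sym (extend-index f i≤k)) (sym (extend-index f 1+i≤k))
      (step (index i≤k) (index 1+i≤k) (trans (toℕ-index 1+i≤k) (cong suc (sym (toℕ-index i≤k)))))
    where
    i≤k : i ≤ k
    i≤k = <⇒≤ 1+i≤k

  module _ (S : VSet n) where

    IsInducedPath⇒InducedPath : ∀ {k} {f : Fin (suc k) → Fin n} →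
                                IsInducedPath G S f → InducedPath G k (extend f)
    IsInducedPath⇒InducedPath {k} {f} (inj , _ , adj⇔consecutive) = record
      { walk      = consecutive⇒Walk (λ i j j≡1+i → proj₂ (adj⇔consecutive i j) (inj₁ j≡1+i))
      ; chordless = λ i≤k j≤k ij → Sum.map (index-suc j≤k i≤k) (index-suc i≤k j≤k)
          (proj₁ (adj⇔consecutive (index i≤k) (index j≤k))
            (subst₂ (λ x y → T (adj G x y)) (extend-index f i≤k) (extend-index f j≤k) ij))
      ; injective = λ i≤k j≤k eq → trans (sym (toℕ-index i≤k)) (trans (cong toℕ (inj
          (trans (sym (extend-index f i≤k)) (trans eq (extend-index f j≤k))))) (toℕ-index j≤k))
      }
      where
      index-suc : ∀ {i j} (i≤k : i ≤ k) (j≤k : j ≤ k) →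
                  toℕ (index i≤k) ≡ suc (toℕ (index j≤k)) → i ≡ suc j
      index-suc i≤k j≤k = subst₂ (λ a b → a ≡ suc b) (toℕ-index i≤k) (toℕ-index j≤k)

    coat⇒InducedPath : ∀ {X c} → coat G S X c →
      ∃₂ λ k g → InducedPath G k g × X (g 0) × X (g k) × ∃ λ i → i ≤ k × g i ≡ c
    coat⇒InducedPath {X} (k , f , f-induced , X₀ , Xₖ , i , refl) =
      k , extend f , IsInducedPath⇒InducedPath f-induced ,
      subst X (sym (extend-toℕ f fzero)) X₀ , subst X (sym (extend-last f)) Xₖ ,
      toℕ i , s≤s⁻¹ (toℕ<n i) , extend-toℕ f i

    Connected⇒Walk : ∀ {X x y} → Connected G S X → X x → X y →
      ∃₂ λ k h → Walk G k h × h 0 ≡ x × h k ≡ y × (∀ {j} → j ≤ k → X (h j))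
    Connected⇒Walk {X} conn x∈X y∈X with conn _ _ x∈X y∈X
    ... | k , f , f₀≡x , fₖ≡y , inX , step =
      k , extend f , consecutive⇒Walk step , trans (extend-toℕ f fzero) f₀≡x , trans (extend-last f) fₖ≡y ,
      λ j≤k → subst X (sym (extend-index f j≤k)) (proj₁ (inX (index j≤k)))

record IntervalModel {c ℓ₁ ℓ₂} (O : DecTotalOrder c ℓ₁ ℓ₂) {n} (G : Graph n) : Set (c ⊔ˡ ℓ₂) where
  open DecTotalOrder O using () renaming (Carrier to Point; _≤_ to _≼_)
  field
    l r         : Fin n → Point
    l≤r         : ∀ v → l v ≼ r v
    adj⇒overlap : ∀ {u v} → T (adj G u v) → l u ≼ r v × l v ≼ r u
    overlap⇒adj : ∀ {u v} → u ≢ v → l u ≼ r v → l v ≼ r u → T (adj G u v)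

IsInterval⇒IntervalModel : ∀ {n} {G : Graph n} → IsInterval G → IntervalModel ≤-decTotalOrder G
IsInterval⇒IntervalModel {G = G} (l , r , l≤r , adj⇔overlap) = record
  { l = l ; r = r ; l≤r = l≤r
  ; adj⇒overlap = λ {u} {v} uv → proj₁ (adj⇔overlap u v (adj⇒≢ G uv)) uv
  ; overlap⇒adj = λ {u} {v} u≢v p q → proj₂ (adj⇔overlap u v u≢v) (p , q)
  }

-- Statements about left endpoints in the mirrored model are statements about right endpoints.
mirror : ∀ {c ℓ₁ ℓ₂} {O : DecTotalOrder c ℓ₁ ℓ₂} {n} {G : Graph n} →
         IntervalModel O G → IntervalModel (Flip.decTotalOrder O) G
mirror M = record
  { l = r ; r = l ; l≤r = l≤r
  ; adj⇒overlap = swap ∘ adj⇒overlap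
  ; overlap⇒adj = λ u≢v p q → overlap⇒adj u≢v q p
  }
  where open IntervalModel M

module IntervalPaths {c ℓ₁ ℓ₂} {O : DecTotalOrder c ℓ₁ ℓ₂} {n} {G : Graph n} (M : IntervalModel O G)
  where

  open DecTotalOrder O using (_≤?_; total)
    renaming (Carrier to Point; _≤_ to _≼_; refl to ≼-refl; trans to ≼-trans)
  open import Relation.Binary.Properties.DecTotalOrder O using (≰⇒≥)
  open IntervalModel M

  Covers : Fin n → Point → Set ℓ₂
  Covers z p = l z ≼ p × p ≼ r z

  Adj⁼⇒overlap : ∀ {a u} → Adj⁼ G a u → l a ≼ r u × l u ≼ r a
  Adj⁼⇒overlap {a} (inj₁ refl) = l≤r a , l≤r a
  Adj⁼⇒overlap (inj₂ au) = adj⇒overlap au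

  overlap⇒Adj⁼ : ∀ {a u} → l a ≼ r u → l u ≼ r a → Adj⁼ G a u
  overlap⇒Adj⁼ {a} {u} p q with a ≟ u
  ... | yes a≡u = inj₁ a≡u
  ... | no a≢u = inj₂ (overlap⇒adj a≢u p q)

  common-point⇒Adj⁼ : ∀ {z w p} → Covers z p → Covers w p → Adj⁼ G z w
  common-point⇒Adj⁼ (lz≼p , p≼rz) (lw≼p , p≼rw) =
    overlap⇒Adj⁼ (≼-trans lz≼p p≼rw) (≼-trans lw≼p p≼rz)

  nested⇒Adj⁼⊆ : ∀ {a b u} → l b ≼ l a → r a ≼ r b → Adj⁼ G a u → Adj⁼ G b u
  nested⇒Adj⁼⊆ lb≼la ra≼rb a∼u with Adj⁼⇒overlap a∼u
  ... | la≼ru , lu≼ra = overlap⇒Adj⁼ (≼-trans lb≼la la≼ru) (≼-trans lu≼ra ra≼rb)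

  walk-covers : ∀ {K h} → Walk G K h → ∀ {i p} → i ≤ K → l (h i) ≼ p → p ≼ r (h K) →
                ∃ λ j → i ≤ j × j ≤ K × Covers (h j) p
  walk-covers {K} {h} w {i} {p} i≤K li≼p p≼rK with l (h K) ≤? p
  ... | yes lK≼p = K , i≤K , ≤-refl , lK≼p , p≼rK
  ... | no lK⋠p with m≤n⇒m<n∨m≡n i≤K
  ...   | inj₂ refl = contradiction li≼p lK⋠p
  walk-covers {suc K} {h} w {i} {p} i≤K li≼p p≼rK | no lK⋠p | inj₁ i<1+K
    with walk-covers (w ∘ m≤n⇒m≤1+n) (s≤s⁻¹ i<1+K) li≼p
           (≼-trans (≰⇒≥ lK⋠p) (proj₂ (adj⇒overlap (w ≤-refl))))
  ... | j , i≤j , j≤K , hj = j , i≤j , m≤n⇒m≤1+n j≤K , hj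

  connected-covers : ∀ {S X x y p} → Connected G S X → X x → X y → l x ≼ p → p ≼ r y →
                     ∃ λ z → X z × Covers z p
  connected-covers {S} {X} conn x∈X y∈X lx≼p p≼ry with Connected⇒Walk G S {X} conn x∈X y∈X
  ... | k , h , w , refl , refl , inX with walk-covers w z≤n lx≼p p≼ry
  ... | j , _ , j≤k , hj = h j , inX j≤k , hj

  module _ {K g} (P : InducedPath G K g) where

    open InducedPath P

    meets-start⇒index1 : ∀ {j p} → 1 ≤ j → j ≤ K → Covers (g 0) p → Covers (g j) p → j ≡ 1
    meets-start⇒index1 1≤j j≤K c₀ cⱼ with common-point⇒Adj⁼ c₀ cⱼ
    ... | inj₁ g₀≡gⱼ = contradiction (injective z≤n j≤K g₀≡gⱼ) (<⇒≢ 1≤j)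
    ... | inj₂ g₀gⱼ with chordless z≤n j≤K g₀gⱼ
    ...   | inj₁ j≡1 = j≡1

    below-start⇒index1 : ∀ {i} → 1 ≤ i → i ≤ K → l (g i) ≼ l (g 0) → l (g 0) ≼ r (g K) → i ≡ 1
    below-start⇒index1 1≤i i≤K li≼l₀ l₀≼rK with walk-covers walk i≤K li≼l₀ l₀≼rK
    ... | j , i≤j , j≤K , cⱼ with meets-start⇒index1 (≤-trans 1≤i i≤j) j≤K (≼-refl , l≤r (g 0)) cⱼ
    ...   | refl = ≤-antisym i≤j 1≤i

    start-ends-before-end : 2 ≤ K → l (g 0) ≼ l (g K) → r (g 0) ≼ r (g K)
    start-ends-before-end 2≤K l₀≼lK with r (g 0) ≤? r (g K)
    ... | yes r₀≼rK = r₀≼rK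
    ... | no r₀⋠rK = contradiction
      (meets-start⇒index1 (<⇒≤ 2≤K) ≤-refl
         (l₀≼lK , ≼-trans (l≤r (g K)) (≰⇒≥ r₀⋠rK)) (≼-refl , l≤r (g K)))
      (<⇒≢ 2≤K ∘ sym)

    start-inside-next : 1 ≤ K → l (g 1) ≼ l (g 0) → r (g 0) ≼ r (g K) → r (g 0) ≼ r (g 1)
    start-inside-next 1≤K l₁≼l₀ r₀≼rK
      with walk-covers walk 1≤K (≼-trans l₁≼l₀ (l≤r (g 0))) r₀≼rK
    ... | j , 1≤j , j≤K , cⱼ with meets-start⇒index1 1≤j j≤K (l≤r (g 0) , ≼-refl) cⱼ
    ...   | refl = proj₂ cⱼ

    module _ (start-max : deg G full (g 0) ≡ Δ G full) where

      start-not-inside-next : 2 ≤ K → l (g 1) ≼ l (g 0) → r (g 0) ≼ r (g 1) → ⊥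
      start-not-inside-next 2≤K l₁≼l₀ r₀≼r₁ =
        <⇒≱ (Adj⁼⊂⇒deg< G (nested⇒Adj⁼⊆ l₁≼l₀ r₀≼r₁) g₀≁g₂ (inj₂ (walk 2≤K)))
            (subst (deg G full (g 1) ≤_) (sym start-max) (deg≤Δ G full (g 1) tt))
        where
        g₀≁g₂ : ¬ Adj⁼ G (g 0) (g 2)
        g₀≁g₂ (inj₁ g₀≡g₂) with injective z≤n 2≤K g₀≡g₂
        ... | ()
        g₀≁g₂ (inj₂ g₀g₂) with chordless z≤n 2≤K g₀g₂
        ... | inj₁ ()
        ... | inj₂ ()

      start-leftmost : l (g 0) ≼ l (g K) → ∀ {i} → i ≤ K → l (g 0) ≼ l (g i)
      start-leftmost l₀≼lK {i} i≤K with l (g 0) ≤? l (g i) | i ≟ℕ 0 | i ≟ℕ K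
      ... | yes l₀≼lᵢ | _ | _ = l₀≼lᵢ
      ... | no l₀⋠lᵢ | yes refl | _ = contradiction ≼-refl l₀⋠lᵢ
      ... | no l₀⋠lᵢ | no _ | yes refl = contradiction l₀≼lK l₀⋠lᵢ
      ... | no l₀⋠lᵢ | no i≢0 | no i≢K
        with below-start⇒index1 (n≢0⇒n>0 i≢0) i≤K (≰⇒≥ l₀⋠lᵢ) (≼-trans l₀≼lK (l≤r (g K)))
      ...   | refl = ⊥-elim (start-not-inside-next 2≤K (≰⇒≥ l₀⋠lᵢ)
                       (start-inside-next i≤K (≰⇒≥ l₀⋠lᵢ) (start-ends-before-end 2≤K l₀≼lK)))
        where
        2≤K : 2 ≤ K
        2≤K = ≤∧≢⇒< i≤K i≢K

  leftmost-at-an-end : ∀ {K g} → InducedPath G K g →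
                       deg G full (g 0) ≡ Δ G full → deg G full (g K) ≡ Δ G full →
                       ∀ {i} → i ≤ K → l (g 0) ≼ l (g i) ⊎ l (g K) ≼ l (g i)
  leftmost-at-an-end {K} {g} P start-max end-max {i} i≤K with total (l (g 0)) (l (g K))
  ... | inj₁ l₀≼lK = inj₁ (start-leftmost P start-max l₀≼lK i≤K)
  ... | inj₂ lK≼l₀ = inj₂ (subst (λ m → l (g K) ≼ l (g m)) (m∸[m∸n]≡n i≤K)
                       (start-leftmost (reverse P) end-max lK≼lK∸K (m∸n≤m K i)))
    where
    lK≼lK∸K : l (g K) ≼ l (g (K ∸ K))
    lK≼lK∸K = subst (λ m → l (g K) ≼ l (g m)) (sym (n∸n≡0 K)) lK≼l₀

module _ {n} (G : Graph n) (iv : IsInterval G) where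

  private
    M : IntervalModel ≤-decTotalOrder G
    M = IsInterval⇒IntervalModel iv

  open IntervalModel M
  open IntervalPaths M
  private
    module Mirrored = IntervalPaths (mirror M)

  Adj⁼⇒common-point : ∀ {c v} → Adj⁼ G c v → ∃ λ t → Covers c t × Covers v t
  Adj⁼⇒common-point {c} {v} c∼v with Adj⁼⇒overlap c∼v
  ... | lc≤rv , lv≤rc =
    l c ⊔ l v , (m≤m⊔n (l c) (l v) , ⊔-lub (l≤r c) lv≤rc) , (m≤n⊔m (l c) (l v) , ⊔-lub lc≤rv (l≤r v))

  coat-VΔ-covered : Connected G full (VΔ G full) → ∀ {c t} → coat G full (VΔ G full) c → Covers c t →
                    ∃ λ z → VΔ G full z × Covers z t
  coat-VΔ-covered conn c∈coat (lc≤t , t≤rc) with coat⇒InducedPath G full {VΔ G full} c∈coat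
  ... | k , g , P , x∈VΔ , y∈VΔ , i , i≤k , refl =
    between-ends
      (Sum.map (λ l₀≤lᵢ → ≤-trans l₀≤lᵢ lc≤t) (λ lₖ≤lᵢ → ≤-trans lₖ≤lᵢ lc≤t)
               (leftmost-at-an-end P (proj₂ x∈VΔ) (proj₂ y∈VΔ) i≤k))
      (Sum.map (≤-trans t≤rc) (≤-trans t≤rc)
               (Mirrored.leftmost-at-an-end P (proj₂ x∈VΔ) (proj₂ y∈VΔ) i≤k))
    where
    covers : ∀ {x y t} → VΔ G full x → VΔ G full y → l x ≤ t → t ≤ r y →
             ∃ λ z → VΔ G full z × Covers z t
    covers = connected-covers {full} {VΔ G full} conn
    between-ends : ∀ {t} → l (g 0) ≤ t ⊎ l (g k) ≤ t → t ≤ r (g 0) ⊎ t ≤ r (g k) →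
                   ∃ λ z → VΔ G full z × Covers z t
    between-ends (inj₁ l₀≤t) (inj₁ t≤r₀) = g 0 , x∈VΔ , l₀≤t , t≤r₀
    between-ends (inj₂ lₖ≤t) (inj₂ t≤rₖ) = g k , y∈VΔ , lₖ≤t , t≤rₖ
    between-ends (inj₁ l₀≤t) (inj₂ t≤rₖ) = covers x∈VΔ y∈VΔ l₀≤t t≤rₖ
    between-ends (inj₂ lₖ≤t) (inj₁ t≤r₀) = covers y∈VΔ x∈VΔ lₖ≤t t≤r₀

  N-bulk≐N-VΔ : Connected G full (VΔ G full) → N[_] G full (bulk G full) ≐ N[_] G full (VΔ G full)
  N-bulk≐N-VΔ conn =
    (λ v → N-coat⊆N-VΔ v ∘ proj₁ (N-Span≐N-coat G full (VΔ G full)) v) ,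
    (λ v → proj₂ (N-Span≐N-coat G full (VΔ G full)) v ∘ N-mono G full (⊆coat G full (λ _ _ → tt)) v)
    where
    N-coat⊆N-VΔ : N[_] G full (coat G full (VΔ G full)) ⊆ N[_] G full (VΔ G full)
    N-coat⊆N-VΔ v (_ , c , c∈coat , c∼v) with Adj⁼⇒common-point c∼v
    ... | t , ct , vt with coat-VΔ-covered conn c∈coat ct
    ...   | z , z∈VΔ , zt = tt , z , z∈VΔ , common-point⇒Adj⁼ zt vt

lemma24 : ∀ {n} (G : Graph n) → IsInterval G →
    (Connected G full (VΔ G full) →
       N[_] G full (bulk G full) ≐ N[_] G full (VΔ G full))
    × (∀ (S : VSet n) → Δ G S ≡ Δ G full →
       N[_] G S (bulk G S) ⊆ N[_] G full (bulk G full))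
    × (∀ (v : Fin n) → Flank G full v →
       N[_] G (delete v) (bulk G (delete v)) ≐ N[_] G full (bulk G full))
lemma24 G iv = N-bulk≐N-VΔ G iv , N-bulk-induced⊆N-bulk G , λ v → N-bulk-delete≐N-bulk G
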